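{- For $n\ge1$ let $\Phi_n(x)=((n+1)x^2-6x-4n)\tilde{U}_n(x)+2(x+2)\tilde{U}_{n-1}(x)+2(x+2)$ and $\tilde{U}^{\mathrm{e}}_n(x)=U^{\mathrm{e}}_n(x/2)$. Then \[ \Phi_n(x)=\tilde{U}^{\mathrm{e}}_n(x)\cdot4Q_n\Big(\frac{x}{2}\Big)=(x-2)^2\cdot\tilde{U}^{\mathrm{e}}_n(x)\cdot R_n(x), \] where $R_n(x)$ is the polynomial defined by $4Q_n(x/2)=(x-2)^2R_n(x)$ (in particular $4Q_n(x/2)$ is divisible by $(x-2)^2$).
   Context: $U_n$ is the Chebyshev polynomial of the second kind, $U_n(\cos\theta)=\sin((n+1)\theta)/\sin\theta$, extended by the recurrence $U_{k+1}(x)=2xU_k(x)-U_{k-1}(x)$ (so $U_{ -1}=0$, $U_{ -2}=-1$); $\tilde{U}_n(x)=U_n(x/2)$. $U^{\mathrm{e}}_n$ is determined by $U^{\mathrm{e}}_n(\cos\theta)=\frac{\sin((n+1)\theta/2)}{\sin(\theta/2)}$ for even $n$ and $\frac{\sin((n+1)\theta/2)}{\sin\theta}$ for odd $n$. $Q_n$ is defined by $Q_{2k}(x)=((2k+1)x^2-3x-2k)(U_k(x)-U_{k-1}(x))+(x+1)(U_{k-1}(x)-U_{k-2}(x))$ for $k\ge1$ and $Q_{2k+1}(x)=((2k+2)x^2-3x-2k-1)(U_{k+1}(x)-U_{k-1}(x))+(x+1)(U_k(x)-U_{k-2}(x))$ for $k\ge0$. -}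

module Defs where

open import Data.Nat.Base as ℕ using (ℕ; zero; suc; ⌊_/2⌋)
open import Data.Bool.Base using (Bool; true; false; if_then_else_)
open import Data.Integer.Base using (+_)
open import Data.Rational.Base using (ℚ; _+_; _*_; _-_; -_; _/_; 0ℚ; 1ℚ; ½)
open import Data.List.Base using (List; []; _∷_)

q : ℕ → ℚ
q n = + n / 1

-- Shifted Chebyshev polynomials of the second kind:
-- Ush m x = U_{m-2}(x), so Ush 0 = U_{-2} = -1, Ush 1 = U_{-1} = 0,
-- and U_{k+1}(x) = 2x U_k(x) - U_{k-1}(x).
Ush : ℕ → ℚ → ℚ
Ush zero x = - 1ℚ
Ush (suc zero) x = 0ℚ
Ush (suc (suc m)) x = q 2 * x * Ush (suc m) x - Ush m x

U : ℕ → ℚ → ℚ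
U k x = Ush (suc (suc k)) x

Ut : ℕ → ℚ → ℚ
Ut n x = U n (x * ½)

Ut-pred : ℕ → ℚ → ℚ
Ut-pred n x = Ush (suc n) (x * ½)

evenᵇ : ℕ → Bool
evenᵇ zero = true
evenᵇ (suc zero) = false
evenᵇ (suc (suc n)) = evenᵇ n

-- U^e_n, as the polynomial in cos θ determined by the trigonometric definition:
-- n = 2k   : sin((2k+1)θ/2)/sin(θ/2) = U_k(cos θ) + U_{k-1}(cos θ)
-- n = 2k+1 : sin((k+1)θ)/sin θ       = U_k(cos θ)
Ue : ℕ → ℚ → ℚ
Ue n x = if evenᵇ n
           then Ush (suc (suc ⌊ n /2⌋)) x + Ush (suc ⌊ n /2⌋) x
           else Ush (suc (suc ⌊ n /2⌋)) x

Uet : ℕ → ℚ → ℚ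
Uet n x = Ue n (x * ½)

Qeven : ℕ → ℚ → ℚ
Qeven k x =
  (q (2 ℕ.* k ℕ.+ 1) * x * x - q 3 * x - q (2 ℕ.* k))
    * (Ush (suc (suc k)) x - Ush (suc k) x)
  + (x + 1ℚ) * (Ush (suc k) x - Ush k x)

Qodd : ℕ → ℚ → ℚ
Qodd k x =
  (q (2 ℕ.* k ℕ.+ 2) * x * x - q 3 * x - q (2 ℕ.* k ℕ.+ 1))
    * (Ush (suc (suc (suc k))) x - Ush (suc k) x)
  + (x + 1ℚ) * (Ush (suc (suc k)) x - Ush k x)

-- Q_n (only meaningful for n ≥ 1; the value at n = 0 is never used)
Q : ℕ → ℚ → ℚ
Q n x = if evenᵇ n then Qeven ⌊ n /2⌋ x else Qodd ⌊ n /2⌋ x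

Φ : ℕ → ℚ → ℚ
Φ n x = (q (n ℕ.+ 1) * x * x - q 6 * x - q (4 ℕ.* n)) * Ut n x
        + q 2 * (x + q 2) * Ut-pred n x
        + q 2 * (x + q 2)

-- polynomials with rational coefficients as coefficient lists (constant term first)
Poly : Set
Poly = List ℚ

eval : Poly → ℚ → ℚ
eval [] x = 0ℚ
eval (a ∷ as) x = a + x * eval as x

{-# OPTIONS --safe #-}

-- Write y = x/2 and D_m = U_{m-1} - U_{m-2}. The product formula
-- U_{a+b} = U_a U_b - U_{a-1} U_{b-1} and Cassini's identity U_{k-1}² - U_k U_{k-2} = 1
-- show that Ũ_n(x) = Ũᵉ_n(x) d₁(y) and Ũ_{n-1}(x) + 1 = Ũᵉ_n(x) d₀(y), where d₁, d₀ are
-- D_{k+1}, D_k for n = 2k and D_{k+2} + D_{k+1}, D_{k+1} + D_k for n = 2k+1. Since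
-- Φ_n = ((n+1)x² - 6x - 4n) Ũ_n + 2(x+2) (Ũ_{n-1} + 1) and
-- 4Q_n(y) = ((n+1)x² - 6x - 4n) d₁(y) + 2(x+2) d₀(y), this gives Φ_n = Ũᵉ_n · 4Q_n(y).
-- For the double root, D_m(y) = 1 + m(m-1)(y-1) + (y-1)² Z_m(y) with Z_m polynomial, and the
-- coefficients of Q_n are exactly those for which the constant and linear terms of Q_n at
-- y = 1 cancel. Since 4(y-1)² = (x-2)², R_n(x) = Q_n(y)/(y-1)².

module Submission where

open import Defs
open import Data.Nat.Base using (ℕ; _≤_)
open import Data.Rational.Base using (ℚ; _*_; _-_; ½)
open import Data.Product using (Σ; _×_)
open import Relation.Binary.PropositionalEquality using (_≡_)

open import Data.Bool.Base using (true; false)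
import Data.Integer.Base as ℤ
import Data.Integer.Properties as ℤ
open import Data.List.Base using ([]; _∷_; map)
open import Data.Nat.Base as ℕ using (zero; suc)
import Data.Nat.Properties as ℕ
open import Data.Nat.Coprimality using (1-coprimeTo) renaming (sym to coprime-sym)
open import Data.Product using (_,_; proj₁; proj₂)
open import Data.Rational.Base using (_+_; -_; 0ℚ; 1ℚ)
open import Data.Rational.Properties
  using (_≟_; +-*-commutativeRing; normalize-coprime; /-cong; +-identityˡ; +-identityʳ; *-zeroˡ; *-zeroʳ)
open import Function.Base using (_∘_)
open import Level using (0ℓ)
open import Relation.Binary.PropositionalEquality
  using (_≗_; refl; sym; trans; cong; cong₂; subst; module ≡-Reasoning)
open import Relation.Nullary.Decidable using (dec⇒maybe)
open import Tactic.RingSolver using (solve-∀)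
import Tactic.RingSolver.Core.AlmostCommutativeRing as ACR

open ≡-Reasoning

ℚ-ring : ACR.AlmostCommutativeRing 0ℓ 0ℓ
ℚ-ring = ACR.fromCommutativeRing +-*-commutativeRing (dec⇒maybe ∘ (0ℚ ≟_))

-- q n is already the normalised fraction n/1, so q n + 1ℚ unfolds to (n·1 + 1·1)/1.
q-suc : ∀ n → q (suc n) ≡ q n + 1ℚ
q-suc n rewrite normalize-coprime (coprime-sym (1-coprimeTo n)) =
  /-cong {ℤ.+ suc n} {1} numerator refl
  where
  numerator : ℤ.+ suc n ≡ ℤ.+ n ℤ.* ℤ.+ 1 ℤ.+ ℤ.+ 1 ℤ.* ℤ.+ 1
  numerator = trans (cong ℤ.+_ (ℕ.+-comm 1 n)) (cong (ℤ._+ ℤ.+ 1) (sym (ℤ.*-identityʳ (ℤ.+ n))))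

q-homo-+ : ∀ m n → q (m ℕ.+ n) ≡ q m + q n
q-homo-+ zero    n = sym (+-identityˡ (q n))
q-homo-+ (suc m) n = begin
  q (suc (m ℕ.+ n))  ≡⟨ q-suc (m ℕ.+ n) ⟩
  q (m ℕ.+ n) + 1ℚ   ≡⟨ cong (_+ 1ℚ) (q-homo-+ m n) ⟩
  q m + q n + 1ℚ     ≡⟨ swap (q m) (q n) ⟩
  q m + 1ℚ + q n     ≡⟨ cong (_+ q n) (sym (q-suc m)) ⟩
  q (suc m) + q n    ∎
  where
  swap : ∀ a b → a + b + 1ℚ ≡ a + 1ℚ + b
  swap = solve-∀ ℚ-ring

q-homo-* : ∀ m n → q (m ℕ.* n) ≡ q m * q n
q-homo-* zero    n = sym (*-zeroˡ (q n))
q-homo-* (suc m) n = begin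
  q (n ℕ.+ m ℕ.* n)    ≡⟨ q-homo-+ n (m ℕ.* n) ⟩
  q n + q (m ℕ.* n)    ≡⟨ cong (q n +_) (q-homo-* m n) ⟩
  q n + q m * q n      ≡⟨ distrib (q m) (q n) ⟩
  (q m + 1ℚ) * q n     ≡⟨ cong (_* q n) (sym (q-suc m)) ⟩
  q (suc m) * q n      ∎
  where
  distrib : ∀ a b → b + a * b ≡ (a + 1ℚ) * b
  distrib = solve-∀ ℚ-ring

-- Chebyshev identities

Ush-add : ∀ y n a → Ush (suc (a ℕ.+ n)) y ≡ Ush (suc a) y * Ush (suc (suc n)) y - Ush a y * Ush (suc n) y
Ush-add y n zero          = base₀ (Ush (suc (suc n)) y) (Ush (suc n) y)
  where
  base₀ : ∀ X Y → Y ≡ 0ℚ * X - (- 1ℚ) * Y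
  base₀ = solve-∀ ℚ-ring
Ush-add y n (suc zero)    = base₁ y (Ush (suc (suc n)) y) (Ush (suc n) y)
  where
  base₁ : ∀ y X Y → X ≡ (q 2 * y * 0ℚ - (- 1ℚ)) * X - 0ℚ * Y
  base₁ = solve-∀ ℚ-ring
Ush-add y n (suc (suc a)) =
  trans (cong₂ (λ s t → q 2 * y * s - t) (Ush-add y n (suc a)) (Ush-add y n a))
        (step y (Ush a y) (Ush (suc a) y) (Ush (suc (suc n)) y) (Ush (suc n) y))
  where
  step : ∀ y u₀ u₁ X Y → let u₂ = q 2 * y * u₁ - u₀ in
         q 2 * y * (u₂ * X - u₁ * Y) - (u₁ * X - u₀ * Y) ≡ (q 2 * y * u₂ - u₁) * X - u₂ * Y
  step = solve-∀ ℚ-ring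

Ush-cassini : ∀ k y → Ush (suc k) y * Ush (suc k) y - Ush (suc (suc k)) y * Ush k y ≡ 1ℚ
Ush-cassini zero    y = base y
  where
  base : ∀ y → 0ℚ * 0ℚ - (q 2 * y * 0ℚ - (- 1ℚ)) * (- 1ℚ) ≡ 1ℚ
  base = solve-∀ ℚ-ring
Ush-cassini (suc k) y = trans (step y (Ush k y) (Ush (suc k) y)) (Ush-cassini k y)
  where
  step : ∀ y a b → let c = q 2 * y * b - a in c * c - (q 2 * y * c - b) * b ≡ b * b - c * a
  step = solve-∀ ℚ-ring

D : ℕ → ℚ → ℚ
D m y = Ush (suc m) y - Ush m y

D-recurrence : ∀ m y → D (suc (suc m)) y ≡ q 2 * y * D (suc m) y - D m y
D-recurrence m y = identity y (Ush m y) (Ush (suc m) y)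
  where
  identity : ∀ y u₀ u₁ → let u₂ = q 2 * y * u₁ - u₀ in
             (q 2 * y * u₂ - u₁) - u₂ ≡ q 2 * y * (u₂ - u₁) - (u₁ - u₀)
  identity = solve-∀ ℚ-ring

Taylor₂ : ℚ → ℚ → ℚ → ℚ → ℚ
Taylor₂ c e z y = c + (y - 1ℚ) * e + (y - 1ℚ) * (y - 1ℚ) * z

Taylor₂-+ : ∀ c e z c′ e′ z′ y → Taylor₂ c e z y + Taylor₂ c′ e′ z′ y ≡ Taylor₂ (c + c′) (e + e′) (z + z′) y
Taylor₂-+ = identity
  where
  identity : ∀ c e z c′ e′ z′ y → let t = y - 1ℚ in
             c + t * e + t * t * z + (c′ + t * e′ + t * t * z′) ≡ c + c′ + t * (e + e′) + t * t * (z + z′)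
  identity = solve-∀ ℚ-ring

-- The remainder of D m at y = 1 (see D-taylor); 2m(m+1) is the term D-recurrence leaves over.
Z : ℕ → ℚ → ℚ
Z zero          y = 0ℚ
Z (suc zero)    y = 0ℚ
Z (suc (suc m)) y = q 2 * y * Z (suc m) y - Z m y + q 2 * q m * (q m + 1ℚ)

D-taylor : ∀ m y → D m y ≡ Taylor₂ 1ℚ (q m * (q m - 1ℚ)) (Z m y) y
D-taylor zero          y = base₀ y
  where
  base₀ : ∀ y → 0ℚ - (- 1ℚ) ≡ 1ℚ + (y - 1ℚ) * (q 0 * (q 0 - 1ℚ)) + (y - 1ℚ) * (y - 1ℚ) * 0ℚ
  base₀ = solve-∀ ℚ-ring
D-taylor (suc zero)    y = base₁ y
  where
  base₁ : ∀ y → (q 2 * y * 0ℚ - (- 1ℚ)) - 0ℚ ≡ 1ℚ + (y - 1ℚ) * (q 1 * (q 1 - 1ℚ)) + (y - 1ℚ) * (y - 1ℚ) * 0ℚ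
  base₁ = solve-∀ ℚ-ring
D-taylor (suc (suc m)) y = begin
  D (suc (suc m)) y
    ≡⟨ D-recurrence m y ⟩
  q 2 * y * D (suc m) y - D m y
    ≡⟨ cong₂ (λ s t → q 2 * y * s - t) (D-taylor (suc m) y) (D-taylor m y) ⟩
  q 2 * y * Taylor₂ 1ℚ (e (q (suc m))) (Z (suc m) y) y - Taylor₂ 1ℚ (e (q m)) (Z m y) y
    ≡⟨ cong (λ M → q 2 * y * Taylor₂ 1ℚ (e M) (Z (suc m) y) y - Taylor₂ 1ℚ (e (q m)) (Z m y) y) (q-suc m) ⟩
  q 2 * y * Taylor₂ 1ℚ (e (q m + 1ℚ)) (Z (suc m) y) y - Taylor₂ 1ℚ (e (q m)) (Z m y) y
    ≡⟨ step y (q m) (Z m y) (Z (suc m) y) ⟩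
  Taylor₂ 1ℚ (e (q m + 1ℚ + 1ℚ)) (Z (suc (suc m)) y) y
    ≡⟨ cong (λ M → Taylor₂ 1ℚ (e M) (Z (suc (suc m)) y) y)
            (sym (trans (q-suc (suc m)) (cong (_+ 1ℚ) (q-suc m)))) ⟩
  Taylor₂ 1ℚ (e (q (suc (suc m)))) (Z (suc (suc m)) y) y ∎
  where
  e : ℚ → ℚ
  e M = M * (M - 1ℚ)
  step : ∀ y M z₀ z₁ → let t = y - 1ℚ; M₁ = M + 1ℚ; M₂ = M₁ + 1ℚ in
         q 2 * y * (1ℚ + t * (M₁ * (M₁ - 1ℚ)) + t * t * z₁) - (1ℚ + t * (M * (M - 1ℚ)) + t * t * z₀)
         ≡ 1ℚ + t * (M₂ * (M₂ - 1ℚ)) + t * t * (q 2 * y * z₁ - z₀ + q 2 * M * (M + 1ℚ))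
  step = solve-∀ ℚ-ring

-- Polynomial functions

infixl 6 _+ₚ_
infixl 7 _·ₚ_ _*ₚ_

_+ₚ_ : Poly → Poly → Poly
[]      +ₚ r       = r
(a ∷ p) +ₚ []      = a ∷ p
(a ∷ p) +ₚ (b ∷ r) = a + b ∷ p +ₚ r

_·ₚ_ : ℚ → Poly → Poly
c ·ₚ p = map (c *_) p

_*ₚ_ : Poly → Poly → Poly
[]      *ₚ r = []
(a ∷ p) *ₚ r = a ·ₚ r +ₚ (0ℚ ∷ p *ₚ r)

eval-+ₚ : ∀ p r x → eval (p +ₚ r) x ≡ eval p x + eval r x
eval-+ₚ []      r       x = sym (+-identityˡ (eval r x))
eval-+ₚ (a ∷ p) []      x = sym (+-identityʳ (eval (a ∷ p) x))
eval-+ₚ (a ∷ p) (b ∷ r) x = begin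
  a + b + x * eval (p +ₚ r) x         ≡⟨ cong (λ s → a + b + x * s) (eval-+ₚ p r x) ⟩
  a + b + x * (eval p x + eval r x)   ≡⟨ identity a b (eval p x) (eval r x) x ⟩
  a + x * eval p x + (b + x * eval r x) ∎
  where
  identity : ∀ a b u v x → a + b + x * (u + v) ≡ a + x * u + (b + x * v)
  identity = solve-∀ ℚ-ring

eval-·ₚ : ∀ c p x → eval (c ·ₚ p) x ≡ c * eval p x
eval-·ₚ c []      x = sym (*-zeroʳ c)
eval-·ₚ c (a ∷ p) x = begin
  c * a + x * eval (c ·ₚ p) x   ≡⟨ cong (λ s → c * a + x * s) (eval-·ₚ c p x) ⟩
  c * a + x * (c * eval p x)    ≡⟨ identity c a (eval p x) x ⟩
  c * (a + x * eval p x)        ∎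
  where
  identity : ∀ c a u x → c * a + x * (c * u) ≡ c * (a + x * u)
  identity = solve-∀ ℚ-ring

eval-*ₚ : ∀ p r x → eval (p *ₚ r) x ≡ eval p x * eval r x
eval-*ₚ []      r x = sym (*-zeroˡ (eval r x))
eval-*ₚ (a ∷ p) r x = begin
  eval (a ·ₚ r +ₚ (0ℚ ∷ p *ₚ r)) x                ≡⟨ eval-+ₚ (a ·ₚ r) (0ℚ ∷ p *ₚ r) x ⟩
  eval (a ·ₚ r) x + (0ℚ + x * eval (p *ₚ r) x)    ≡⟨ cong₂ (λ s t → s + (0ℚ + x * t)) (eval-·ₚ a r x) (eval-*ₚ p r x) ⟩
  a * eval r x + (0ℚ + x * (eval p x * eval r x)) ≡⟨ identity a (eval p x) (eval r x) x ⟩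
  (a + x * eval p x) * eval r x                   ∎
  where
  identity : ∀ a u v x → a * v + (0ℚ + x * (u * v)) ≡ (a + x * u) * v
  identity = solve-∀ ℚ-ring

IsPolynomial : (ℚ → ℚ) → Set
IsPolynomial f = Σ Poly λ p → ∀ x → f x ≡ eval p x

module _ {f g : ℚ → ℚ} where

  poly-resp-≗ : f ≗ g → IsPolynomial g → IsPolynomial f
  poly-resp-≗ f≗g (p , g≗p) = p , λ x → trans (f≗g x) (g≗p x)

  poly-+ : IsPolynomial f → IsPolynomial g → IsPolynomial (λ x → f x + g x)
  poly-+ (p , f≗p) (r , g≗r) = p +ₚ r , λ x →
    trans (cong₂ _+_ (f≗p x) (g≗r x)) (sym (eval-+ₚ p r x))

  poly-* : IsPolynomial f → IsPolynomial g → IsPolynomial (λ x → f x * g x)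
  poly-* (p , f≗p) (r , g≗r) = p *ₚ r , λ x →
    trans (cong₂ _*_ (f≗p x) (g≗r x)) (sym (eval-*ₚ p r x))

poly-const : ∀ c → IsPolynomial (λ _ → c)
poly-const c = c ∷ [] , λ x → identity c x
  where
  identity : ∀ c x → c ≡ c + x * 0ℚ
  identity = solve-∀ ℚ-ring

poly-id : IsPolynomial (λ x → x)
poly-id = 0ℚ ∷ 1ℚ ∷ [] , identity
  where
  identity : ∀ x → x ≡ 0ℚ + x * (1ℚ + x * 0ℚ)
  identity = solve-∀ ℚ-ring

poly-neg : ∀ {f} → IsPolynomial f → IsPolynomial (λ x → - f x)
poly-neg F = poly-resp-≗ (λ x → identity _) (poly-* (poly-const (- 1ℚ)) F)
  where
  identity : ∀ u → - u ≡ - 1ℚ * u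
  identity = solve-∀ ℚ-ring

poly-∘ : ∀ {f g} → IsPolynomial f → IsPolynomial g → IsPolynomial (f ∘ g)
poly-∘ {f} {g} (p , f≗p) G = poly-resp-≗ (f≗p ∘ g) (eval-∘ p)
  where
  eval-∘ : ∀ p → IsPolynomial (λ x → eval p (g x))
  eval-∘ []      = poly-const 0ℚ
  eval-∘ (a ∷ p) = poly-+ (poly-const a) (poly-* G (eval-∘ p))

Z-polynomial : ∀ m → IsPolynomial (Z m)
Z-polynomial zero          = poly-const 0ℚ
Z-polynomial (suc zero)    = poly-const 0ℚ
Z-polynomial (suc (suc m)) =
  poly-+ (poly-+ (poly-* (poly-* (poly-const (q 2)) poly-id) (Z-polynomial (suc m)))
                 (poly-neg (Z-polynomial m)))
         (poly-const (q 2 * q m * (q m + 1ℚ)))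

-- The factorisation

Q-form : ℚ → ℚ → ℚ → ℚ → ℚ → ℚ
Q-form a b d₁ d₀ y = (a * y * y - q 3 * y - b) * d₁ + (y + 1ℚ) * d₀

Φ≡e*4Q-form : ∀ n x e d₁ d₀ → Ut n x ≡ e * d₁ → Ut-pred n x + 1ℚ ≡ e * d₀ →
              Φ n x ≡ e * (q 4 * Q-form (q (n ℕ.+ 1)) (q n) d₁ d₀ (x * ½))
Φ≡e*4Q-form n x e d₁ d₀ Ut≡e*d₁ Ut-pred+1≡e*d₀ = begin
  Φ n x
    ≡⟨ cong (λ b → P b * Ut n x + q 2 * (x + q 2) * Ut-pred n x + q 2 * (x + q 2)) (q-homo-* 4 n) ⟩
  P (q 4 * q n) * Ut n x + q 2 * (x + q 2) * Ut-pred n x + q 2 * (x + q 2)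
    ≡⟨ regroup (P (q 4 * q n)) (q 2 * (x + q 2)) (Ut n x) (Ut-pred n x) ⟩
  P (q 4 * q n) * Ut n x + q 2 * (x + q 2) * (Ut-pred n x + 1ℚ)
    ≡⟨ cong₂ (λ u v → P (q 4 * q n) * u + q 2 * (x + q 2) * v) Ut≡e*d₁ Ut-pred+1≡e*d₀ ⟩
  P (q 4 * q n) * (e * d₁) + q 2 * (x + q 2) * (e * d₀)
    ≡⟨ halve (q (n ℕ.+ 1)) (q n) x e d₁ d₀ ⟩
  e * (q 4 * Q-form (q (n ℕ.+ 1)) (q n) d₁ d₀ (x * ½)) ∎
  where
  P : ℚ → ℚ
  P b = q (n ℕ.+ 1) * x * x - q 6 * x - b
  regroup : ∀ p c u v → p * u + c * v + c ≡ p * u + c * (v + 1ℚ)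
  regroup = solve-∀ ℚ-ring
  halve : ∀ a b x e d₁ d₀ → let y = x * ½ in
          (a * x * x - q 6 * x - q 4 * b) * (e * d₁) + q 2 * (x + q 2) * (e * d₀)
          ≡ e * (q 4 * ((a * y * y - q 3 * y - b) * d₁ + (y + 1ℚ) * d₀))
  halve = solve-∀ ℚ-ring

Q-cofactor : ℚ → ℚ → ℚ → ℚ → ℚ → ℚ → ℚ
Q-cofactor b c e z₁ z₀ y =
  c * a + (q 2 * a - q 3) * e₁ + e + a * e₁ * (y - 1ℚ) + (a * y * y - q 3 * y - b) * z₁ + (y + 1ℚ) * z₀
  where
  a e₁ : ℚ
  a  = b + 1ℚ
  e₁ = e + c * b

Q-form-double-root : ∀ b c e z₁ z₀ y →
  Q-form (b + 1ℚ) b (Taylor₂ c (e + c * b) z₁ y) (Taylor₂ c e z₀ y) y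
  ≡ (y - 1ℚ) * (y - 1ℚ) * Q-cofactor b c e z₁ z₀ y
Q-form-double-root = identity
  where
  identity : ∀ b c e z₁ z₀ y → let a = b + 1ℚ; e₁ = e + c * b; t = y - 1ℚ in
    (a * y * y - q 3 * y - b) * (c + t * e₁ + t * t * z₁) + (y + 1ℚ) * (c + t * e + t * t * z₀)
    ≡ t * t * (c * a + (q 2 * a - q 3) * e₁ + e + a * e₁ * t + (a * y * y - q 3 * y - b) * z₁ + (y + 1ℚ) * z₀)
  identity = solve-∀ ℚ-ring

Q-cofactor-polynomial : ∀ b c e {z₁ z₀} → IsPolynomial z₁ → IsPolynomial z₀ →
                        IsPolynomial (λ y → Q-cofactor b c e (z₁ y) (z₀ y) y)
Q-cofactor-polynomial b c e Z₁ Z₀ =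
  poly-+ (poly-+ (poly-+ (poly-const (c * a + (q 2 * a - q 3) * e₁ + e))
                         (poly-* (poly-const (a * e₁)) (poly-+ poly-id (poly-const (- 1ℚ)))))
                 (poly-* P Z₁))
         (poly-* (poly-+ poly-id (poly-const 1ℚ)) Z₀)
  where
  a e₁ : ℚ
  a  = b + 1ℚ
  e₁ = e + c * b
  P : IsPolynomial (λ y → a * y * y - q 3 * y - b)
  P = poly-+ (poly-+ (poly-* (poly-* (poly-const a) poly-id) poly-id)
                     (poly-neg (poly-* (poly-const (q 3)) poly-id)))
             (poly-neg (poly-const b))

record Splitting (n : ℕ) : Set where
  field
    d₁ d₀                : ℚ → ℚ
    Ut≡Uet*d₁            : ∀ x → Ut n x ≡ Uet n x * d₁ (x * ½)
    Ut-pred+1≡Uet*d₀     : ∀ x → Ut-pred n x + 1ℚ ≡ Uet n x * d₀ (x * ½)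
    Q≡Q-form             : ∀ y → Q n y ≡ Q-form (q (n ℕ.+ 1)) (q n) (d₁ y) (d₀ y) y
    c e                  : ℚ
    z₁ z₀                : ℚ → ℚ
    d₁-taylor            : ∀ y → d₁ y ≡ Taylor₂ c (e + c * q n) (z₁ y) y
    d₀-taylor            : ∀ y → d₀ y ≡ Taylor₂ c e (z₀ y) y
    z₁-polynomial        : IsPolynomial z₁
    z₀-polynomial        : IsPolynomial z₀

data ParityView : ℕ → Set where
  even : ∀ k → ParityView (k ℕ.+ k)
  odd  : ∀ k → ParityView (suc (k ℕ.+ k))

parityView : ∀ n → ParityView n
parityView zero = even 0
parityView (suc n) with parityView n
... | even k = odd k
... | odd  k = subst ParityView (cong suc (ℕ.+-suc k k)) (even (suc k))

evenᵇ-double : ∀ k → evenᵇ (k ℕ.+ k) ≡ true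
evenᵇ-double zero    = refl
evenᵇ-double (suc k) rewrite ℕ.+-suc k k = evenᵇ-double k

evenᵇ-odd : ∀ k → evenᵇ (suc (k ℕ.+ k)) ≡ false
evenᵇ-odd zero    = refl
evenᵇ-odd (suc k) rewrite ℕ.+-suc k k = evenᵇ-odd k

Ue-even : ∀ k y → Ue (k ℕ.+ k) y ≡ Ush (suc (suc k)) y + Ush (suc k) y
Ue-even k y rewrite evenᵇ-double k | sym (ℕ.n≡⌊n+n/2⌋ k) = refl

Q-even : ∀ k y → Q (k ℕ.+ k) y ≡ Qeven k y
Q-even k y rewrite evenᵇ-double k | sym (ℕ.n≡⌊n+n/2⌋ k) = refl

Ue-odd : ∀ k y → Ue (suc (k ℕ.+ k)) y ≡ Ush (suc (suc k)) y
Ue-odd k y rewrite evenᵇ-odd k | sym (ℕ.n≡⌈n+n/2⌉ k) = refl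

Q-odd : ∀ k y → Q (suc (k ℕ.+ k)) y ≡ Qodd k y
Q-odd k y rewrite evenᵇ-odd k | sym (ℕ.n≡⌈n+n/2⌉ k) = refl

2*k≡k+k : ∀ k → 2 ℕ.* k ≡ k ℕ.+ k
2*k≡k+k k = cong (k ℕ.+_) (ℕ.+-identityʳ k)

splitting-even : ∀ k → Splitting (k ℕ.+ k)
splitting-even k = record
  { d₁               = D (suc k)
  ; d₀               = D k
  ; Ut≡Uet*d₁        = Ut≡Uet*d₁
  ; Ut-pred+1≡Uet*d₀ = Ut-pred+1≡Uet*d₀
  ; Q≡Q-form         = λ y → trans (Q-even k y)
      (cong (λ m → Q-form (q (m ℕ.+ 1)) (q m) (D (suc k) y) (D k y) y) (2*k≡k+k k))
  ; c                = 1ℚ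
  ; e                = q k * (q k - 1ℚ)
  ; z₁               = Z (suc k)
  ; z₀               = Z k
  ; d₁-taylor        = λ y → trans (D-taylor (suc k) y) (cong (λ e → Taylor₂ 1ℚ e (Z (suc k) y) y) slope)
  ; d₀-taylor        = D-taylor k
  ; z₁-polynomial    = Z-polynomial (suc k)
  ; z₀-polynomial    = Z-polynomial k
  }
  where
  slope : q (suc k) * (q (suc k) - 1ℚ) ≡ q k * (q k - 1ℚ) + 1ℚ * q (k ℕ.+ k)
  slope rewrite q-suc k | q-homo-+ k k = identity (q k)
    where
    identity : ∀ K → (K + 1ℚ) * (K + 1ℚ - 1ℚ) ≡ K * (K - 1ℚ) + 1ℚ * (K + K)
    identity = solve-∀ ℚ-ring

  module _ (x : ℚ) where
    y A B C : ℚ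
    y = x * ½
    A = Ush (suc (suc k)) y
    B = Ush (suc k) y
    C = Ush k y

    Ut≡Uet*d₁ : Ut (k ℕ.+ k) x ≡ Uet (k ℕ.+ k) x * D (suc k) y
    Ut≡Uet*d₁ = begin
      Ut (k ℕ.+ k) x               ≡⟨ Ush-add y k (suc k) ⟩
      A * A - B * B                ≡⟨ identity A B ⟩
      (A + B) * (A - B)            ≡⟨ cong (_* (A - B)) (sym (Ue-even k y)) ⟩
      Uet (k ℕ.+ k) x * (A - B)    ∎
      where
      identity : ∀ A B → A * A - B * B ≡ (A + B) * (A - B)
      identity = solve-∀ ℚ-ring

    Ut-pred+1≡Uet*d₀ : Ut-pred (k ℕ.+ k) x + 1ℚ ≡ Uet (k ℕ.+ k) x * D k y
    Ut-pred+1≡Uet*d₀ = begin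
      Ut-pred (k ℕ.+ k) x + 1ℚ          ≡⟨ cong₂ _+_ (Ush-add y k k) (sym (Ush-cassini k y)) ⟩
      (B * A - C * B) + (B * B - A * C) ≡⟨ identity A B C ⟩
      (A + B) * (B - C)                 ≡⟨ cong (_* (B - C)) (sym (Ue-even k y)) ⟩
      Uet (k ℕ.+ k) x * (B - C)         ∎
      where
      identity : ∀ A B C → (B * A - C * B) + (B * B - A * C) ≡ (A + B) * (B - C)
      identity = solve-∀ ℚ-ring

splitting-odd : ∀ k → Splitting (suc (k ℕ.+ k))
splitting-odd k = record
  { d₁               = λ y → D (suc (suc k)) y + D (suc k) y
  ; d₀               = λ y → D (suc k) y + D k y
  ; Ut≡Uet*d₁        = Ut≡Uet*d₁
  ; Ut-pred+1≡Uet*d₀ = Ut-pred+1≡Uet*d₀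
  ; Q≡Q-form         = Q≡Q-form
  ; c                = 1ℚ + 1ℚ
  ; e                = q (suc k) * (q (suc k) - 1ℚ) + q k * (q k - 1ℚ)
  ; z₁               = λ y → Z (suc (suc k)) y + Z (suc k) y
  ; z₀               = λ y → Z (suc k) y + Z k y
  ; d₁-taylor        = λ y → trans (pair-taylor (suc k) y)
      (cong (λ e → Taylor₂ (1ℚ + 1ℚ) e (Z (suc (suc k)) y + Z (suc k) y) y) slope)
  ; d₀-taylor        = pair-taylor k
  ; z₁-polynomial    = poly-+ (Z-polynomial (suc (suc k))) (Z-polynomial (suc k))
  ; z₀-polynomial    = poly-+ (Z-polynomial (suc k)) (Z-polynomial k)
  }
  where
  pair-taylor : ∀ m y → D (suc m) y + D m y
                ≡ Taylor₂ (1ℚ + 1ℚ) (q (suc m) * (q (suc m) - 1ℚ) + q m * (q m - 1ℚ)) (Z (suc m) y + Z m y) y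
  pair-taylor m y = trans (cong₂ _+_ (D-taylor (suc m) y) (D-taylor m y))
                          (Taylor₂-+ 1ℚ _ (Z (suc m) y) 1ℚ _ (Z m y) y)

  slope : q (suc (suc k)) * (q (suc (suc k)) - 1ℚ) + q (suc k) * (q (suc k) - 1ℚ)
          ≡ q (suc k) * (q (suc k) - 1ℚ) + q k * (q k - 1ℚ) + (1ℚ + 1ℚ) * q (suc (k ℕ.+ k))
  slope rewrite q-suc (suc k) | q-suc (k ℕ.+ k) | q-suc k | q-homo-+ k k = identity (q k)
    where
    identity : ∀ K → let K₁ = K + 1ℚ; K₂ = K₁ + 1ℚ in
               K₂ * (K₂ - 1ℚ) + K₁ * (K₁ - 1ℚ) ≡ K₁ * (K₁ - 1ℚ) + K * (K - 1ℚ) + (1ℚ + 1ℚ) * (K + K + 1ℚ)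
    identity = solve-∀ ℚ-ring

  Q≡Q-form : ∀ y → Q (suc (k ℕ.+ k)) y
             ≡ Q-form (q (suc (k ℕ.+ k) ℕ.+ 1)) (q (suc (k ℕ.+ k)))
                      (D (suc (suc k)) y + D (suc k) y) (D (suc k) y + D k y) y
  Q≡Q-form y = begin
    Q (suc (k ℕ.+ k)) y
      ≡⟨ Q-odd k y ⟩
    Q-form (q (2 ℕ.* k ℕ.+ 2)) (q (2 ℕ.* k ℕ.+ 1)) (A⁺ - B) (A - C) y
      ≡⟨ cong₂ (λ d₁ d₀ → Q-form (q (2 ℕ.* k ℕ.+ 2)) (q (2 ℕ.* k ℕ.+ 1)) d₁ d₀ y)
               (telescope A⁺ A B) (telescope A B C) ⟩
    Q-form (q (2 ℕ.* k ℕ.+ 2)) (q (2 ℕ.* k ℕ.+ 1)) (A⁺ - A + (A - B)) (A - B + (B - C)) y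
      ≡⟨ cong₂ (λ a b → Q-form (q a) (q b) (A⁺ - A + (A - B)) (A - B + (B - C)) y)
               (trans (cong (ℕ._+ 2) (2*k≡k+k k)) (ℕ.+-suc (k ℕ.+ k) 1))
               (trans (cong (ℕ._+ 1) (2*k≡k+k k)) (ℕ.+-comm (k ℕ.+ k) 1)) ⟩
    Q-form (q (suc (k ℕ.+ k) ℕ.+ 1)) (q (suc (k ℕ.+ k))) (A⁺ - A + (A - B)) (A - B + (B - C)) y ∎
    where
    A⁺ A B C : ℚ
    A⁺ = Ush (suc (suc (suc k))) y
    A  = Ush (suc (suc k)) y
    B  = Ush (suc k) y
    C  = Ush k y
    telescope : ∀ a b c → a - c ≡ (a - b) + (b - c)
    telescope = solve-∀ ℚ-ring

  module _ (x : ℚ) where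
    y A⁺ A B C : ℚ
    y  = x * ½
    A⁺ = Ush (suc (suc (suc k))) y
    A  = Ush (suc (suc k)) y
    B  = Ush (suc k) y
    C  = Ush k y

    Ut≡Uet*d₁ : Ut (suc (k ℕ.+ k)) x ≡ Uet (suc (k ℕ.+ k)) x * (A⁺ - A + (A - B))
    Ut≡Uet*d₁ = begin
      Ut (suc (k ℕ.+ k)) x                  ≡⟨ Ush-add y k (suc (suc k)) ⟩
      A⁺ * A - A * B                        ≡⟨ identity A⁺ A B ⟩
      A * (A⁺ - A + (A - B))                ≡⟨ cong (_* (A⁺ - A + (A - B))) (sym (Ue-odd k y)) ⟩
      Uet (suc (k ℕ.+ k)) x * (A⁺ - A + (A - B)) ∎
      where
      identity : ∀ A⁺ A B → A⁺ * A - A * B ≡ A * (A⁺ - A + (A - B))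
      identity = solve-∀ ℚ-ring

    Ut-pred+1≡Uet*d₀ : Ut-pred (suc (k ℕ.+ k)) x + 1ℚ ≡ Uet (suc (k ℕ.+ k)) x * (A - B + (B - C))
    Ut-pred+1≡Uet*d₀ = begin
      Ut-pred (suc (k ℕ.+ k)) x + 1ℚ      ≡⟨ cong₂ _+_ (Ush-add y k (suc k)) (sym (Ush-cassini k y)) ⟩
      (A * A - B * B) + (B * B - A * C)   ≡⟨ identity A B C ⟩
      A * (A - B + (B - C))               ≡⟨ cong (_* (A - B + (B - C))) (sym (Ue-odd k y)) ⟩
      Uet (suc (k ℕ.+ k)) x * (A - B + (B - C)) ∎
      where
      identity : ∀ A B C → (A * A - B * B) + (B * B - A * C) ≡ A * (A - B + (B - C))
      identity = solve-∀ ℚ-ring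

splitting : ∀ n → Splitting n
splitting n with parityView n
... | even k = splitting-even k
... | odd  k = splitting-odd k

Φ≡Uet*4Q : ∀ n x → Φ n x ≡ Uet n x * (q 4 * Q n (x * ½))
Φ≡Uet*4Q n x = begin
  Φ n x
    ≡⟨ Φ≡e*4Q-form n x (Uet n x) (d₁ (x * ½)) (d₀ (x * ½)) (Ut≡Uet*d₁ x) (Ut-pred+1≡Uet*d₀ x) ⟩
  Uet n x * (q 4 * Q-form (q (n ℕ.+ 1)) (q n) (d₁ (x * ½)) (d₀ (x * ½)) (x * ½))
    ≡⟨ cong (λ t → Uet n x * (q 4 * t)) (sym (Q≡Q-form (x * ½))) ⟩
  Uet n x * (q 4 * Q n (x * ½)) ∎
  where open Splitting (splitting n)

R : ℕ → ℚ → ℚ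
R n x = Q-cofactor (q n) c e (z₁ (x * ½)) (z₀ (x * ½)) (x * ½)
  where open Splitting (splitting n)

R-polynomial : ∀ n → IsPolynomial (R n)
R-polynomial n = poly-∘ (Q-cofactor-polynomial (q n) c e z₁-polynomial z₀-polynomial)
                        (poly-* poly-id (poly-const ½))
  where open Splitting (splitting n)

4Q≡[x-2]²R : ∀ n x → q 4 * Q n (x * ½) ≡ (x - q 2) * (x - q 2) * R n x
4Q≡[x-2]²R n x = begin
  q 4 * Q n y
    ≡⟨ cong (q 4 *_) (Q≡Q-form y) ⟩
  q 4 * Q-form (q (n ℕ.+ 1)) (q n) (d₁ y) (d₀ y) y
    ≡⟨ cong (λ a → q 4 * Q-form a (q n) (d₁ y) (d₀ y) y) (q-homo-+ n 1) ⟩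
  q 4 * Q-form (q n + 1ℚ) (q n) (d₁ y) (d₀ y) y
    ≡⟨ cong₂ (λ u v → q 4 * Q-form (q n + 1ℚ) (q n) u v y) (d₁-taylor y) (d₀-taylor y) ⟩
  q 4 * Q-form (q n + 1ℚ) (q n) (Taylor₂ c (e + c * q n) (z₁ y) y) (Taylor₂ c e (z₀ y) y) y
    ≡⟨ cong (q 4 *_) (Q-form-double-root (q n) c e (z₁ y) (z₀ y) y) ⟩
  q 4 * ((y - 1ℚ) * (y - 1ℚ) * R n x)
    ≡⟨ double x (R n x) ⟩
  (x - q 2) * (x - q 2) * R n x ∎
  where
  open Splitting (splitting n)
  y : ℚ
  y = x * ½
  double : ∀ x r → q 4 * ((x * ½ - 1ℚ) * (x * ½ - 1ℚ) * r) ≡ (x - q 2) * (x - q 2) * r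
  double = solve-∀ ℚ-ring

theoremB7 : (n : ℕ) → 1 ≤ n →
    ((x : ℚ) → Φ n x ≡ Uet n x * (q 4 * Q n (x * ½)))
    × Σ Poly (λ R →
        ((x : ℚ) → q 4 * Q n (x * ½) ≡ (x - q 2) * (x - q 2) * eval R x)
        × ((x : ℚ) → Φ n x ≡ (x - q 2) * (x - q 2) * Uet n x * eval R x))
theoremB7 n _ = Φ≡Uet*4Q n , Rₚ , 4Q≡[x-2]²Rₚ , Φ≡[x-2]²Uet*Rₚ
  where
  Rₚ : Poly
  Rₚ = proj₁ (R-polynomial n)

  4Q≡[x-2]²Rₚ : ∀ x → q 4 * Q n (x * ½) ≡ (x - q 2) * (x - q 2) * eval Rₚ x
  4Q≡[x-2]²Rₚ x = trans (4Q≡[x-2]²R n x) (cong ((x - q 2) * (x - q 2) *_) (proj₂ (R-polynomial n) x))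

  Φ≡[x-2]²Uet*Rₚ : ∀ x → Φ n x ≡ (x - q 2) * (x - q 2) * Uet n x * eval Rₚ x
  Φ≡[x-2]²Uet*Rₚ x = begin
    Φ n x                                             ≡⟨ Φ≡Uet*4Q n x ⟩
    Uet n x * (q 4 * Q n (x * ½))                     ≡⟨ cong (Uet n x *_) (4Q≡[x-2]²Rₚ x) ⟩
    Uet n x * ((x - q 2) * (x - q 2) * eval Rₚ x)     ≡⟨ reorder (Uet n x) (x - q 2) (eval Rₚ x) ⟩
    (x - q 2) * (x - q 2) * Uet n x * eval Rₚ x       ∎
    where
    reorder : ∀ u s r → u * (s * s * r) ≡ s * s * u * r
    reorder = solve-∀ ℚ-ring
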